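{- The assignment sending each set to itself and each graph $\gamma: A\to B$ to the relation $C(\gamma)\subseteq (A\times A)\times(B\times B)$ defined by $C(\gamma)(a,a',b,b')\iff \{(a,b),(a',b')\}\in E(\gamma)$ is an identity-on-objects functor $C:\mathcal{G}\to\mathrm{CPM}(\mathbf{Rel})$.
   Context: $\mathbf{Rel}$: sets and binary relations, dagger the converse relation; a relation $P: X\to X$ is positive if $P=T^\dagger\circ T$ for some relation $T: X\to Y$. $\mathrm{CPM}(\mathbf{Rel})$ has sets as objects; a morphism $A\to B$ is a relation $R\subseteq(A\times A)\times(B\times B)$ such that the relation $\overline{R}$ on $A\times B$, $\overline{R}((a_1,b_1),(a_2,b_2))\iff R(a_2,a_1,b_2,b_1)$, is positive; composition is $(S\circ R)(a,a',c,c')\iff\exists b,b'.\ R(a,a',b,b')\wedge S(b,b',c,c')$ and the identity is $1_A(a_1,a_2,a_3,a_4)\iff a_1=a_3\wedge a_2=a_4$. A graph is a vertex set $W$ with a set $E$ of unordered pairs $\{v,w\}$ of vertices ($v=w$ allowed) such that $\{v\}\in E$ for every $v\in W$; write $V(\gamma),E(\gamma)$. The category $\mathcal{G}$ has sets as objects; a morphism $\gamma: A\to B$ is a graph whose vertex set is a subset of $A\times B$; composition of $\gamma: A\to B$, $\gamma': B\to C$ is given by $V(\gamma'\circ\gamma)=\{(a,c)\mid\exists b.\ (a,b)\in V(\gamma)\wedge(b,c)\in V(\gamma')\}$, $E(\gamma'\circ\gamma)=\{\{(a,c),(a',c')\}\mid\exists b,b'.\ \{(a,b),(a',b')\}\in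 E(\gamma)\wedge\{(b,c),(b',c')\}\in E(\gamma')\}$; the identity $1_A$ is the complete graph on the diagonal $\{(a,a)\mid a\in A\}$. -}

module Defs where

open import Data.Product using (Σ; Σ-syntax; ∃; _×_; _,_; proj₁; proj₂)
open import Function.Bundles using (_⇔_)
open import Relation.Binary.PropositionalEquality using (_≡_)

RelM : Set → Set → Set₁
RelM X Y = X → Y → Set

_≈R_ : {X Y : Set} → RelM X Y → RelM X Y → Set
_≈R_ {X} {Y} R S = (x : X) (y : Y) → R x y ⇔ S x y

_∘R_ : {X Y Z : Set} → RelM Y Z → RelM X Y → RelM X Z
_∘R_ {Y = Y} S T x z = Σ[ y ∈ Y ] (T x y × S y z)

_† : {X Y : Set} → RelM X Y → RelM Y X
(T †) y x = T x y

Positive : {X : Set} → RelM X X → Set₁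
Positive {X} P = Σ[ Y ∈ Set ] Σ[ T ∈ RelM X Y ] (P ≈R ((T †) ∘R T))

-- a candidate morphism A → B: a relation R ⊆ (A × A) × (B × B),
-- written curried: R a a' b b'
CPMRel : Set → Set → Set₁
CPMRel A B = A → A → B → B → Set

bar : {A B : Set} → CPMRel A B → RelM (A × B) (A × B)
bar R (a₁ , b₁) (a₂ , b₂) = R a₂ a₁ b₂ b₁

IsCPM : {A B : Set} → CPMRel A B → Set₁
IsCPM R = Positive (bar R)

_≈C_ : {A B : Set} → CPMRel A B → CPMRel A B → Set
_≈C_ {A} {B} R S = (a a' : A) (b b' : B) → R a a' b b' ⇔ S a a' b b'

_∘C_ : {A B C : Set} → CPMRel B C → CPMRel A B → CPMRel A C
_∘C_ {B = B} S R a a' c c' = Σ[ b ∈ B ] Σ[ b' ∈ B ] (R a a' b b' × S b b' c c')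

idC : (A : Set) → CPMRel A A
idC A a₁ a₂ a₃ a₄ = (a₁ ≡ a₃) × (a₂ ≡ a₄)

-- Graphs.  An unordered pair {v,w} ∈ E is encoded by a symmetric binary
-- predicate edge v w (v = w allowed); every edge joins vertices, and every
-- vertex carries its loop {v}.

record Graph (W : Set) : Set₁ where
  field
    vertex    : W → Set
    edge      : W → W → Set
    edge-sym  : ∀ {v w} → edge v w → edge w v
    edge-vert : ∀ {v w} → edge v w → vertex v × vertex w
    loop      : ∀ {v} → vertex v → edge v v
open Graph public

GMor : Set → Set → Set₁
GMor A B = Graph (A × B)

_≈G_ : {A B : Set} → GMor A B → GMor A B → Set
_≈G_ {A} {B} γ δ =
  ((v : A × B) → vertex γ v ⇔ vertex δ v) ×
  ((v w : A × B) → edge γ v w ⇔ edge δ v w)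

idG : (A : Set) → GMor A A
idG A = record
  { vertex = λ v → proj₁ v ≡ proj₂ v
  ; edge = λ v w → (proj₁ v ≡ proj₂ v) × (proj₁ w ≡ proj₂ w)
  ; edge-sym = λ { (p , q) → q , p }
  ; edge-vert = λ e → e
  ; loop = λ p → p , p
  }

_∘G_ : {A B C : Set} → GMor B C → GMor A B → GMor A C
_∘G_ {A} {B} {C} γ' γ = record
  { vertex = λ { (a , c) → Σ[ b ∈ B ] (vertex γ (a , b) × vertex γ' (b , c)) }
  ; edge = λ { (a , c) (a' , c') → Σ[ b ∈ B ] Σ[ b' ∈ B ]
                 (edge γ (a , b) (a' , b') × edge γ' (b , c) (b' , c')) }
  ; edge-sym = λ { (b , b' , e , e') → b' , b , edge-sym γ e , edge-sym γ' e' }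
  ; edge-vert = λ { (b , b' , e , e') →
        (b , proj₁ (edge-vert γ e) , proj₁ (edge-vert γ' e'))
      , (b' , proj₂ (edge-vert γ e) , proj₂ (edge-vert γ' e')) }
  ; loop = λ { (b , v , v') → b , b , loop γ v , loop γ' v' }
  }

Cmor : {A B : Set} → GMor A B → CPMRel A B
Cmor γ a a' b b' = edge γ (a , b) (a' , b')

IsIdOnObjFunctorC : Set₁
IsIdOnObjFunctorC =
    ({A B : Set} (γ : GMor A B) → IsCPM (Cmor γ))
  × ({A B : Set} (γ δ : GMor A B) → γ ≈G δ → Cmor γ ≈C Cmor δ)
  × ((A : Set) → Cmor (idG A) ≈C idC A)
  × ({A B C : Set} (γ : GMor A B) (γ' : GMor B C) →
       Cmor (γ' ∘G γ) ≈C (Cmor γ' ∘C Cmor γ))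

-- The only non-trivial part is that C(γ) is a morphism of CPM(Rel), i.e. that
-- the relation C(γ)‾ on A × B is positive.  Unfolding the definitions,
-- C(γ)‾(x, y) is just "{y, x} is an edge of γ", so it suffices to prove a
-- general fact about Rel: a symmetric relation E on X that is reflexive on
-- its field (E x y implies E x x and E y y) is positive.  The witness is the
-- incidence relation T from X to the set of edges, relating x to each edge
-- {p, q} it lies on: then T† ∘ T relates x and z iff they share an edge,
-- which by symmetry and the loop condition happens iff E x z.
-- The edge relation of a graph has both properties (edges are symmetric and
-- every vertex carries its loop).

module Submission where

open import Defs
open import Data.Product using (Σ-syntax; _×_; _,_; proj₁; proj₂)
open import Data.Sum using (_⊎_; inj₁; inj₂)
open import Function.Base using (id)
open import Function.Bundles using (mk⇔)
open import Relation.Binary.PropositionalEquality using (_≡_; refl)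

Symmetric : {X : Set} → RelM X X → Set
Symmetric {X} E = {x y : X} → E x y → E y x

ReflexiveOnField : {X : Set} → RelM X X → Set
ReflexiveOnField {X} E = {x y : X} → E x y → E x x × E y y

module _ {X : Set} (E : RelM X X) where

  Edge : Set
  Edge = Σ[ pq ∈ X × X ] E (proj₁ pq) (proj₂ pq)

  Incidence : RelM X Edge
  Incidence x ((p , q) , _) = x ≡ p ⊎ x ≡ q

  related⇒shareEdge : ∀ x z → E x z → ((Incidence †) ∘R Incidence) x z
  related⇒shareEdge x z e = ((x , z) , e) , inj₁ refl , inj₂ refl

  shareEdge⇒related : Symmetric E → ReflexiveOnField E →
                      ∀ x z → ((Incidence †) ∘R Incidence) x z → E x z
  shareEdge⇒related sym refl-on _ _ ((_ , e) , inj₁ refl , inj₁ refl) = proj₁ (refl-on e)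
  shareEdge⇒related sym refl-on _ _ ((_ , e) , inj₁ refl , inj₂ refl) = e
  shareEdge⇒related sym refl-on _ _ ((_ , e) , inj₂ refl , inj₁ refl) = sym e
  shareEdge⇒related sym refl-on _ _ ((_ , e) , inj₂ refl , inj₂ refl) = proj₂ (refl-on e)

  symmetric-reflexiveOnField⇒positive :
    Symmetric E → ReflexiveOnField E → Positive E
  symmetric-reflexiveOnField⇒positive sym refl-on =
    Edge , Incidence , λ x z →
      mk⇔ (related⇒shareEdge x z) (shareEdge⇒related sym refl-on x z)

-- C(γ)‾ is the converse of the edge relation of γ, which is symmetric and
-- reflexive on its field since every endpoint of an edge carries a loop.
Cmor-isCPM : {A B : Set} (γ : GMor A B) → IsCPM (Cmor γ)
Cmor-isCPM γ = symmetric-reflexiveOnField⇒positive (bar (Cmor γ))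
  (edge-sym γ)
  (λ e → loop γ (proj₂ (edge-vert γ e)) , loop γ (proj₁ (edge-vert γ e)))

Cmor-resp-≈ : {A B : Set} (γ δ : GMor A B) → γ ≈G δ → Cmor γ ≈C Cmor δ
Cmor-resp-≈ γ δ (_ , sameEdges) a a' b b' = sameEdges (a , b) (a' , b')

Cmor-id : (A : Set) → Cmor (idG A) ≈C idC A
Cmor-id A a a' b b' = mk⇔ id id

Cmor-∘ : {A B C : Set} (γ : GMor A B) (γ' : GMor B C) →
         Cmor (γ' ∘G γ) ≈C (Cmor γ' ∘C Cmor γ)
Cmor-∘ γ γ' a a' c c' = mk⇔ id id

proposition4p11 : IsIdOnObjFunctorC
proposition4p11 = Cmor-isCPM , Cmor-resp-≈ , Cmor-id , Cmor-∘
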